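{- The relations $\mathrm{Abv}(x,y,z):=(y<x\wedge xy\perp z)\vee(z<x\wedge xz\perp y)$ and $U(x,y,z):=(y<x\vee z<x)\wedge y\perp z$ are primitive positive definable in $(P;\mathrm{Low})$.
   Context: $\mathbb{P}=(P;\leq)$ is the random partial order (the unique countable homogeneous partial order embedding all finite partial orders); $x<y$ means $x\leq y\wedge x\neq y$, $x\perp y$ incomparability; $xy\perp z$ means $x\perp z\wedge y\perp z$. $\mathrm{Low}(x,y,z):=(x<y\wedge z\perp xy)\vee(x<z\wedge y\perp xz)$. Primitive positive definable means definable by $\exists\bar y(\psi_1\wedge\dots\wedge\psi_m)$ with atomic $\psi_i$. -}

module Defs where

open import Data.Nat using (ℕ; _+_)
open import Data.Fin using (Fin; zero; suc)
open import Data.Product using (Σ; ∃; _×_; _,_)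
open import Data.Sum using (_⊎_)
open import Data.List using (List)
open import Data.List.Relation.Unary.All using (All)
open import Relation.Binary.PropositionalEquality using (_≡_; _≢_)
open import Relation.Binary.Structures using (IsPartialOrder)
open import Relation.Nullary using (¬_)
open import Function.Bundles using (_↔_; _⇔_; Inverse)

-- The random partial order, characterised as in the paper (Fraïssé):
-- a countable partial order (equality = _≡_) that is homogeneous
-- (every isomorphism between finite substructures extends to an automorphism)
-- and embeds every finite partial order.
record IsRandomPartialOrder (P : Set) (_≤_ : P → P → Set) : Set₁ where
  field
    isPartialOrder : IsPartialOrder _≡_ _≤_
    countable      : Σ (ℕ → P) (λ e → ∀ x → ∃ λ n → e n ≡ x)
    universal      : ∀ n (R : Fin n → Fin n → Set) → IsPartialOrder _≡_ R →
                     Σ (Fin n → P) (λ f → ∀ i j → R i j ⇔ (f i ≤ f j))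
    -- a finite partial isomorphism f i ↦ g i (order preserving and reflecting;
    -- injectivity/well-definedness follow from antisymmetry) extends to an automorphism
    homogeneous    : ∀ n (f g : Fin n → P) →
                     (∀ i j → (f i ≤ f j) ⇔ (g i ≤ g j)) →
                     Σ (P ↔ P) (λ σ →
                       (∀ x y → (x ≤ y) ⇔ (Inverse.to σ x ≤ Inverse.to σ y)) ×
                       (∀ i → Inverse.to σ (f i) ≡ g i))

-- Variables 0,1,2 are the free variables
-- x,y,z; variables 3,...,3+k-1 are existentially quantified.
data Atom (n : ℕ) : Set where
  rel : Fin n → Fin n → Fin n → Atom n
  eq  : Fin n → Fin n → Atom n

record PPFormula3 : Set where
  field
    nExists : ℕ
    atoms   : List (Atom (3 + nExists))

module _ {P : Set} where

  env : ∀ {k} → P → P → P → (Fin k → P) → Fin (3 + k) → P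
  env x y z w zero = x
  env x y z w (suc zero) = y
  env x y z w (suc (suc zero)) = z
  env x y z w (suc (suc (suc i))) = w i

  holds : ∀ {n} → (P → P → P → Set) → (Fin n → P) → Atom n → Set
  holds L ρ (rel i j l) = L (ρ i) (ρ j) (ρ l)
  holds L ρ (eq i j)    = ρ i ≡ ρ j

  Sat : (P → P → P → Set) → (φ : PPFormula3) → P → P → P → Set
  Sat L φ x y z = Σ (Fin (PPFormula3.nExists φ) → P)
                    (λ w → All (holds L (env x y z w)) (PPFormula3.atoms φ))

  PPDefinable3 : (P → P → P → Set) → (P → P → P → Set) → Set
  PPDefinable3 L S = Σ PPFormula3 (λ φ → ∀ x y z → S x y z ⇔ Sat L φ x y z)

module Relations {P : Set} (_≤_ : P → P → Set) where

  _<_ : P → P → Set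
  x < y = (x ≤ y) × (x ≢ y)

  _⊥_ : P → P → Set
  x ⊥ y = ¬ (x ≤ y) × ¬ (y ≤ x)

  Low : P → P → P → Set
  Low x y z = ((x < y) × (z ⊥ x) × (z ⊥ y)) ⊎ ((x < z) × (y ⊥ x) × (y ⊥ z))

  Abv : P → P → P → Set
  Abv x y z = ((y < x) × (x ⊥ z) × (y ⊥ z)) ⊎ ((z < x) × (x ⊥ y) × (z ⊥ y))

  U : P → P → P → Set
  U x y z = ((y < x) ⊎ (z < x)) × (y ⊥ z)

module Submission where

--   φAbv(x,y,z) = ∃ u v w. Low(x,u,v) ∧ Low(y,x,w) ∧ Low(y,z,u) ∧ Low(z,x,w)
--                         ∧ Low(z,y,v) ∧ Low(w,u,v)
--   x' < x     ⇔ ∃ a b. Low(x',x,a) ∧ Low(a,x',b)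
--   U(x,y,z)   ⇔ ∃ x'. Abv(x',y,z) ∧ x' < x,   which gives φU.
--
-- Soundness holds in every partial order: the atoms Low(y,z,u), Low(z,y,v) force
-- y ⊥ z, y < u ⊥ z and z < v ⊥ y; the atoms through w say which of y, z lies below x,
-- and Low(x,u,v), Low(w,u,v) exclude that both or neither do, since a common upper
-- bound of y and z cannot lie below u or v.
-- Completeness uses the extension property of the random partial order: a finite
-- partial order (given by a table) extending the order type of finitely many points
-- is realised over them.  The case z < x of Abv reduces to y < x by the symmetry
-- Low(a,b,c) ⇔ Low(a,c,b).  For U, a point x' with y < x' < x and x' ⊥ z is obtained
-- by realising a one-point extension of P that fills the cut between y and x.

open import Defs
open import Data.Bool using (Bool; true; false; T; not; _∧_; _∨_)
open import Data.Bool.Properties using (T-∧; T-∨)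
open import Data.Empty using (⊥-elim)
open import Data.Fin using (Fin; zero; suc; #_; toℕ; splitAt; _↑ˡ_; _↑ʳ_)
open import Data.Fin.Properties using (all?; _≟_; splitAt⁻¹-↑ˡ; splitAt⁻¹-↑ʳ)
open import Data.List using (List; []; _∷_)
open import Data.Bool.ListAction using (all; any)
open import Data.List.Relation.Unary.All as All using (All; []; _∷_)
open import Data.Maybe using (Maybe; just; nothing)
open import Data.Maybe.Properties using (just-injective)
open import Data.Nat using (ℕ; _+_; _≡ᵇ_)
open import Data.Product using (Σ; _×_; _,_; proj₁; proj₂) renaming (swap to ×-swap)
open import Data.Sum using (inj₁; inj₂)
import Data.Sum as Sum
open import Data.Unit using (⊤; tt)
open import Data.Vec.Functional using (Vector; _++_) renaming ([] to []ᵥ; _∷_ to _∷ᵥ_)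
open import Data.Vec.Functional.Properties using (lookup-++ˡ; lookup-++ʳ)
open import Function using (_∘_)
open import Function.Bundles using (_⇔_; mk⇔; Equivalence; Inverse)
open import Function.Construct.Composition using (_⇔-∘_)
open import Function.Construct.Symmetry using (⇔-sym)
open import Function.Definitions using (Injective)
open import Relation.Binary.PropositionalEquality
  using (_≡_; _≢_; refl; sym; trans; cong; subst; isEquivalence)
open import Relation.Binary.Structures using (IsPartialOrder)
open import Relation.Nullary using (¬_)
open import Relation.Nullary.Decidable using (True; toWitness; ⌊_⌋; _→-dec_)
open import Relation.Nullary.Decidable.Core using (T?)
import Relation.Binary.Construct.NonStrictToStrict as NonStrictToStrict

++-halves : ∀ {A : Set} {m k} (ρ : Vector A (m + k)) (a : Vector A m) →
            (∀ i → ρ (i ↑ˡ k) ≡ a i) → ∀ i → (a ++ (ρ ∘ (m ↑ʳ_))) i ≡ ρ i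
++-halves {m = m} ρ a agree i with splitAt m i in split
... | inj₁ j = trans (sym (agree j)) (cong ρ (splitAt⁻¹-↑ˡ split))
... | inj₂ j = cong ρ (splitAt⁻¹-↑ʳ split)

++-injective : ∀ {A : Set} {m k} (a : Vector A m) (b : Vector A k) →
               Injective _≡_ _≡_ a → Injective _≡_ _≡_ b → (∀ i j → a i ≢ b j) →
               Injective _≡_ _≡_ (a ++ b)
++-injective {m = m} a b a-inj b-inj disjoint {i} {j} same
  with splitAt m i in split-i | splitAt m j in split-j
... | inj₁ i' | inj₁ j' = trans (sym (splitAt⁻¹-↑ˡ split-i))
                                (trans (cong (_↑ˡ _) (a-inj same)) (splitAt⁻¹-↑ˡ split-j))
... | inj₁ i' | inj₂ j' = ⊥-elim (disjoint i' j' same)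
... | inj₂ i' | inj₁ j' = ⊥-elim (disjoint j' i' (sym same))
... | inj₂ i' | inj₂ j' = trans (sym (splitAt⁻¹-↑ʳ split-i))
                                (trans (cong (m ↑ʳ_) (b-inj same)) (splitAt⁻¹-↑ʳ split-j))

∷-injective : ∀ {A : Set} {m} {a : A} {v : Vector A m} →
              Injective _≡_ _≡_ v → (∀ i → a ≢ v i) → Injective _≡_ _≡_ (a ∷ᵥ v)
∷-injective v-inj fresh {zero}  {zero}  _    = refl
∷-injective v-inj fresh {zero}  {suc j} same = ⊥-elim (fresh j same)
∷-injective v-inj fresh {suc i} {zero}  same = ⊥-elim (fresh i (sym same))
∷-injective v-inj fresh {suc i} {suc j} same = cong suc (v-inj same)

distinct₃ : ∀ {A : Set} {a b c : A} → a ≢ b → a ≢ c → b ≢ c →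
            Injective _≡_ _≡_ (a ∷ᵥ b ∷ᵥ c ∷ᵥ []ᵥ)
distinct₃ a≢b a≢c b≢c =
  ∷-injective (∷-injective (∷-injective (λ { {()} }) (λ ()))
                           (λ { zero → b≢c ; (suc ()) }))
              (λ { zero → a≢b ; (suc zero) → a≢c ; (suc (suc ())) })

⇔-cong : ∀ {A B : Set} (R : A → A → Set) (S : B → B → Set) {a a' b b' : A} {c c' e e' : B} →
         a ≡ a' → b ≡ b' → c ≡ c' → e ≡ e' → R a b ⇔ S c e → R a' b' ⇔ S c' e'
⇔-cong R S refl refl refl refl h = h

env-++ : ∀ {P : Set} {k} (x y z : P) (w : Vector P k) →
         ∀ i → ((x ∷ᵥ y ∷ᵥ z ∷ᵥ []ᵥ) ++ w) i ≡ env x y z w i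
env-++ x y z w zero                = refl
env-++ x y z w (suc zero)          = refl
env-++ x y z w (suc (suc zero))    = refl
env-++ x y z w (suc (suc (suc i))) = refl

holds-cong : ∀ {P : Set} {n} {L : P → P → P → Set} {ρ σ : Fin n → P} →
             (∀ i → ρ i ≡ σ i) → ∀ atom → holds L ρ atom → holds L σ atom
holds-cong ρ≗σ (rel i j l) h rewrite ρ≗σ i | ρ≗σ j | ρ≗σ l = h
holds-cong ρ≗σ (eq i j) h = trans (sym (ρ≗σ i)) (trans h (ρ≗σ j))

sat-from-++ : ∀ {P : Set} {L : P → P → P → Set} (φ : PPFormula3) {x y z : P}
              (w : Vector P (PPFormula3.nExists φ)) →
              All (holds L ((x ∷ᵥ y ∷ᵥ z ∷ᵥ []ᵥ) ++ w)) (PPFormula3.atoms φ) → Sat L φ x y z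
sat-from-++ {L = L} φ {x} {y} {z} w atoms =
  w , All.map (λ {α} → holds-cong {L = L} (env-++ x y z w) α) atoms

pullback-isPartialOrder : ∀ {A B : Set} {_⊑_ : B → B → Set} (f : A → B) →
  Injective _≡_ _≡_ f → IsPartialOrder _≡_ _⊑_ → IsPartialOrder _≡_ (λ i j → f i ⊑ f j)
pullback-isPartialOrder f f-inj ⊑-po = record
  { isPreorder = record
    { isEquivalence = isEquivalence
    ; reflexive     = λ { refl → IsPartialOrder.refl ⊑-po }
    ; trans         = IsPartialOrder.trans ⊑-po
    }
  ; antisym = λ p q → f-inj (IsPartialOrder.antisym ⊑-po p q)
  }

pairsTable : ∀ {n} → List (ℕ × ℕ) → Fin n → Fin n → Bool
pairsTable pairs i j =
  (toℕ i ≡ᵇ toℕ j) ∨ any (λ { (a , b) → (toℕ i ≡ᵇ a) ∧ (toℕ j ≡ᵇ b) }) pairs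

tablePartialOrder : ∀ {n} (t : Fin n → Fin n → Bool) →
  True (all? (λ i → T? (t i i))) →
  True (all? (λ i → all? (λ j → all? (λ k → T? (t i j) →-dec (T? (t j k) →-dec T? (t i k)))))) →
  True (all? (λ i → all? (λ j → T? (t i j) →-dec (T? (t j i) →-dec (i ≟ j))))) →
  IsPartialOrder _≡_ (λ i j → T (t i j))
tablePartialOrder t reflexive transitive antisymmetric = record
  { isPreorder = record
    { isEquivalence = isEquivalence
    ; reflexive     = λ { {i} refl → toWitness reflexive i }
    ; trans         = λ {i} {j} {k} → toWitness transitive i j k
    }
  ; antisym = λ {i} {j} → toWitness antisymmetric i j
  }

T-not : ∀ {b} → T (not b) → ¬ T b
T-not {true}  () _
T-not {false} _  ()

holds⇔ : ∀ {A : Set} → A → T true ⇔ A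
holds⇔ a = mk⇔ (λ _ → a) (λ _ → tt)

fails⇔ : ∀ {A : Set} → ¬ A → T false ⇔ A
fails⇔ ¬a = mk⇔ (λ ()) (⊥-elim ∘ ¬a)

module TableRelations {n} (t : Fin n → Fin n → Bool) where
  belowB : Fin n → Fin n → Bool
  belowB i j = t i j ∧ not (t j i)

  incomparableB : Fin n → Fin n → Bool
  incomparableB i j = not (t i j) ∧ not (t j i)

  lowSideB : Fin n → Fin n → Fin n → Bool
  lowSideB a b c = belowB a b ∧ (incomparableB c a ∧ incomparableB c b)

  lowB : Fin n → Fin n → Fin n → Bool
  lowB a b c = lowSideB a b c ∨ lowSideB a c b

  atomB : Atom n → Bool
  atomB (rel a b c) = lowB a b c
  atomB (eq i j)    = ⌊ i ≟ j ⌋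

φAbv : PPFormula3
φAbv = record
  { nExists = 3
  ; atoms   = rel x u v ∷ rel y x w ∷ rel y z u ∷ rel z x w ∷ rel z y v ∷ rel w u v ∷ [] }
  where
  x y z u v w : Fin 6
  x = # 0 ; y = # 1 ; z = # 2 ; u = # 3 ; v = # 4 ; w = # 5

-- φU(x,y,z) = ∃ x' u v w a b. φAbv(x',y,z) (with witnesses u v w) ∧ Low(x',x,a) ∧ Low(a,x',b)
φU : PPFormula3
φU = record
  { nExists = 6
  ; atoms   = rel x' u v ∷ rel y x' w ∷ rel y z u ∷ rel z x' w ∷ rel z y v ∷ rel w u v ∷
              rel x' x a ∷ rel a x' b ∷ [] }
  where
  x y z x' u v w a b : Fin 9
  x = # 0 ; y = # 1 ; z = # 2 ; x' = # 3 ; u = # 4 ; v = # 5 ; w = # 6 ; a = # 7 ; b = # 8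

-- Witness tables.  Points 0,1,2 are the base points, the rest are the witnesses.

-- For φAbv when y < x, x ⊥ z, y ⊥ z; points x y z u v w with y < x < u and z < w < v.
abvTable : Fin 6 → Fin 6 → Bool
abvTable = pairsTable ((0 , 3) ∷ (1 , 0) ∷ (1 , 3) ∷ (2 , 4) ∷ (2 , 5) ∷ (5 , 4) ∷ [])

-- For x' < x; points x' x a b with x' < x and a < b, other pairs incomparable.
belowTable : Fin 4 → Fin 4 → Bool
belowTable = pairsTable ((0 , 1) ∷ (2 , 3) ∷ [])

module OrderFacts {P : Set} {_≤_ : P → P → Set} (po : IsPartialOrder _≡_ _≤_) where
  open Relations _≤_
  open IsPartialOrder po using (antisym) renaming (refl to ≤-refl; trans to ≤-trans)
  open NonStrictToStrict _≡_ _≤_ using (<-trans; <-asym; <⇒≱)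

  ⊥-sym : ∀ {a b} → a ⊥ b → b ⊥ a
  ⊥-sym = ×-swap

  low-swap : ∀ {a b c} → Low a b c → Low a c b
  low-swap = Sum.swap

  below⇒¬low : ∀ {a c d} → a < c → ¬ Low c a d
  below⇒¬low a<c (inj₁ (c<a , _))      = <-asym antisym a<c c<a
  below⇒¬low a<c (inj₂ (_ , a⊥c , _)) = proj₁ a⊥c (proj₁ a<c)

  mutual-low : ∀ {y z u v} → Low y z u → Low z y v → (y < u) × (z ⊥ y) × (z ⊥ u)
  mutual-low (inj₁ (y<z , _)) zyv = ⊥-elim (below⇒¬low y<z zyv)
  mutual-low (inj₂ facts)     _   = facts

  upper-bound⇒¬low : ∀ {p u v y z} → z < p → ¬ (z ≤ u) → y < p → ¬ (y ≤ v) → ¬ Low p u v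
  upper-bound⇒¬low z<p z≰u _   _   (inj₁ (p<u , _)) = z≰u (proj₁ (<-trans po z<p p<u))
  upper-bound⇒¬low _   _   y<p y≰v (inj₂ (p<v , _)) = y≰v (proj₁ (<-trans po y<p p<v))

  low-below : ∀ {a b c d} → Low a b c → Low c a d → a < b
  low-below (inj₁ (a<b , _)) _   = a<b
  low-below (inj₂ (a<c , _)) cad = ⊥-elim (below⇒¬low a<c cad)

  abv-sound : ∀ {x y z u v w} → Low x u v → Low y x w → Low y z u → Low z x w →
              Low z y v → Low w u v → Abv x y z
  abv-sound xuv yxw yzu zxw zyv wuv with mutual-low yzu zyv | mutual-low zyv yzu
  ... | _ , z⊥y , z⊥u | _ , y⊥z , y⊥v with yxw | zxw
  ...   | inj₁ (y<x , _)     | inj₁ (z<x , _) =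
          ⊥-elim (upper-bound⇒¬low z<x (proj₁ z⊥u) y<x (proj₁ y⊥v) xuv)
  ...   | inj₁ (y<x , _)     | inj₂ (_ , x⊥z , _) = inj₁ (y<x , x⊥z , y⊥z)
  ...   | inj₂ (_ , x⊥y , _) | inj₁ (z<x , _)     = inj₂ (z<x , x⊥y , z⊥y)
  ...   | inj₂ (y<w , _)     | inj₂ (z<w , _) =
          ⊥-elim (upper-bound⇒¬low z<w (proj₁ z⊥u) y<w (proj₁ y⊥v) wuv)

  abv-from-φAbv : ∀ {x y z} → Sat Low φAbv x y z → Abv x y z
  abv-from-φAbv (_ , xuv ∷ yxw ∷ yzu ∷ zxw ∷ zyv ∷ wuv ∷ []) = abv-sound xuv yxw yzu zxw zyv wuv

  -- Soundness of φU: φAbv(x',y,z) puts y or z below x' < x, and y ⊥ z.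
  u-from-φU : ∀ {x y z} → Sat Low φU x y z → U x y z
  u-from-φU (_ , x'uv ∷ yx'w ∷ yzu ∷ zx'w ∷ zyv ∷ wuv ∷ x'xa ∷ ax'b ∷ [])
    with abv-sound x'uv yx'w yzu zx'w zyv wuv
  ... | inj₁ (y<x' , _ , y⊥z) = inj₁ (<-trans po y<x' (low-below x'xa ax'b)) , y⊥z
  ... | inj₂ (z<x' , _ , z⊥y) = inj₂ (<-trans po z<x' (low-below x'xa ax'b)) , ⊥-sym z⊥y

  -- φAbv is symmetric in y and z: exchange the witnesses u and v.
  φAbv-swap : ∀ {x y z} → Sat Low φAbv x z y → Sat Low φAbv x y z
  φAbv-swap (w , xuv ∷ zxw ∷ zyu ∷ yxw ∷ yzv ∷ wuv ∷ []) =
    (w (# 1) ∷ᵥ w (# 0) ∷ᵥ w (# 2) ∷ᵥ []ᵥ) ,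
    low-swap xuv ∷ yxw ∷ yzv ∷ zxw ∷ zyu ∷ low-swap wuv ∷ []

  -- The one-point extension of P by a point filling the cut above c and below d.
  Cut : P → P → Maybe P → Maybe P → Set
  Cut c d (just a) (just b) = a ≤ b
  Cut c d (just a) nothing  = a ≤ c
  Cut c d nothing  (just b) = d ≤ b
  Cut c d nothing  nothing  = ⊤

  cut-isPartialOrder : ∀ {c d} → c < d → IsPartialOrder _≡_ (Cut c d)
  cut-isPartialOrder {c} {d} (c≤d , c≢d) = record
    { isPreorder = record
      { isEquivalence = isEquivalence
      ; reflexive     = λ { {just a} refl → ≤-refl ; {nothing} refl → tt }
      ; trans         = λ {p} {q} {r} → cut-trans p q r
      }
    ; antisym = λ {p} {q} → cut-antisym p q
    }
    where
    cut-trans : ∀ p q r → Cut c d p q → Cut c d q r → Cut c d p r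
    cut-trans (just a) (just b) (just e) a≤b b≤e = ≤-trans a≤b b≤e
    cut-trans (just a) (just b) nothing  a≤b b≤c = ≤-trans a≤b b≤c
    cut-trans (just a) nothing  (just e) a≤c d≤e = ≤-trans a≤c (≤-trans c≤d d≤e)
    cut-trans (just a) nothing  nothing  a≤c _   = a≤c
    cut-trans nothing  (just b) (just e) d≤b b≤e = ≤-trans d≤b b≤e
    cut-trans nothing  (just b) nothing  _   _   = tt
    cut-trans nothing  nothing  (just e) _   d≤e = d≤e
    cut-trans nothing  nothing  nothing  _   _   = tt

    d≰c : ¬ (d ≤ c)
    d≰c = <⇒≱ antisym (c≤d , c≢d)

    cut-antisym : ∀ p q → Cut c d p q → Cut c d q p → p ≡ q
    cut-antisym (just a) (just b) a≤b b≤a = cong just (antisym a≤b b≤a)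
    cut-antisym (just a) nothing  a≤c d≤a = ⊥-elim (d≰c (≤-trans d≤a a≤c))
    cut-antisym nothing  (just b) d≤b b≤c = ⊥-elim (d≰c (≤-trans d≤b b≤c))
    cut-antisym nothing  nothing  _   _   = refl

  module TableFacts {n} (t : Fin n → Fin n → Bool) (ρ : Fin n → P)
                    (realises : ∀ i j → T (t i j) ⇔ (ρ i ≤ ρ j)) where
    open TableRelations t

    below : ∀ i j → T (belowB i j) → ρ i < ρ j
    below i j h with Equivalence.to T-∧ h
    ... | i≤j , j≰i = Equivalence.to (realises i j) i≤j ,
                      λ same → T-not j≰i (Equivalence.from (realises j i) (subst (_≤ ρ i) same ≤-refl))

    incomparable : ∀ i j → T (incomparableB i j) → ρ i ⊥ ρ j
    incomparable i j h with Equivalence.to T-∧ h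
    ... | i≰j , j≰i = T-not i≰j ∘ Equivalence.from (realises i j) ,
                      T-not j≰i ∘ Equivalence.from (realises j i)

    lowSide : ∀ a b c → T (lowSideB a b c) → (ρ a < ρ b) × (ρ c ⊥ ρ a) × (ρ c ⊥ ρ b)
    lowSide a b c h with Equivalence.to T-∧ h
    ... | a<b , h′ with Equivalence.to T-∧ h′
    ...   | c⊥a , c⊥b = below a b a<b , incomparable c a c⊥a , incomparable c b c⊥b

    low : ∀ a b c → T (lowB a b c) → Low (ρ a) (ρ b) (ρ c)
    low a b c h = Sum.map (lowSide a b c) (lowSide a c b) (Equivalence.to T-∨ h)

    atoms : ∀ (φ : List (Atom n)) → T (all atomB φ) → All (holds Low ρ) φ
    atoms []       _ = []
    atoms (α ∷ φ) h with Equivalence.to T-∧ h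
    ... | hα , hφ = atom α hα ∷ atoms φ hφ
      where
      atom : ∀ α → T (atomB α) → holds Low ρ α
      atom (rel a b c) h = low a b c h
      atom (eq i j)    h = cong ρ (toWitness h)

module RandomOrder {P : Set} {_≤_ : P → P → Set} (rpo : IsRandomPartialOrder P _≤_) where
  open Relations _≤_
  open IsRandomPartialOrder rpo
  open IsPartialOrder isPartialOrder using (antisym) renaming (refl to ≤-refl; trans to ≤-trans)
  open NonStrictToStrict _≡_ _≤_ using (<⇒≱)
  open OrderFacts isPartialOrder

  extend : ∀ {m k} (a : Vector P m) (R : Fin (m + k) → Fin (m + k) → Set) →
           IsPartialOrder _≡_ R → (∀ i j → R (i ↑ˡ k) (j ↑ˡ k) ⇔ (a i ≤ a j)) →
           Σ (Vector P k) λ w → ∀ i j → R i j ⇔ ((a ++ w) i ≤ (a ++ w) j)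
  extend {m} {k} a R R-po base with universal (m + k) R R-po
  ... | f , f-embeds with homogeneous m (f ∘ (_↑ˡ k)) a (λ i j → base i j ⇔-∘ ⇔-sym (f-embeds _ _))
  ... | σ , σ-embeds , σ-fixes = ρ ∘ (m ↑ʳ_) , realises
    where
    ρ : Vector P (m + k)
    ρ = Inverse.to σ ∘ f

    halves : ∀ i → (a ++ (ρ ∘ (m ↑ʳ_))) i ≡ ρ i
    halves = ++-halves ρ a σ-fixes

    realises : ∀ i j → R i j ⇔ ((a ++ (ρ ∘ (m ↑ʳ_))) i ≤ (a ++ (ρ ∘ (m ↑ʳ_))) j)
    realises i j = ⇔-cong R _≤_ refl refl (sym (halves i)) (sym (halves j))
                          (σ-embeds (f i) (f j) ⇔-∘ f-embeds i j)

  -- It is obtained by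
  -- realising the cut extension restricted to the points a and one new point.
  module CutFilling {m} (a : Vector P m) (a-inj : Injective _≡_ _≡_ a) {c d : P} (c<d : c < d) where
    new : Vector (Maybe P) 1
    new _ = nothing

    points : Vector (Maybe P) (m + 1)
    points = (just ∘ a) ++ new

    points-inj : Injective _≡_ _≡_ points
    points-inj = ++-injective (just ∘ a) new
                              (a-inj ∘ just-injective) (λ { {zero} {zero} _ → refl })
                              (λ _ _ ())

    R : Fin (m + 1) → Fin (m + 1) → Set
    R i j = Cut c d (points i) (points j)

    base : ∀ i j → R (i ↑ˡ 1) (j ↑ˡ 1) ⇔ (a i ≤ a j)
    base i j = ⇔-cong (Cut c d) _≤_ (sym (lookup-++ˡ (just ∘ a) new i))
                      (sym (lookup-++ˡ (just ∘ a) new j)) refl refl (mk⇔ (λ h → h) (λ h → h))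

    filled : Σ P λ p → ∀ i → ((a i ≤ p) ⇔ (a i ≤ c)) × ((p ≤ a i) ⇔ (d ≤ a i))
    filled with extend a R (pullback-isPartialOrder points points-inj (cut-isPartialOrder c<d)) base
    ... | w , realises = w zero , λ i → ⇔-sym (old-new i) , ⇔-sym (new-old i)
      where
      old-new : ∀ i → (a i ≤ c) ⇔ (a i ≤ w zero)
      old-new i = ⇔-cong (Cut c d) _≤_ (lookup-++ˡ (just ∘ a) new i) (lookup-++ʳ (just ∘ a) new zero)
                         (lookup-++ˡ a w i) (lookup-++ʳ a w zero) (realises (i ↑ˡ 1) (m ↑ʳ zero))
      new-old : ∀ i → (d ≤ a i) ⇔ (w zero ≤ a i)
      new-old i = ⇔-cong (Cut c d) _≤_ (lookup-++ʳ (just ∘ a) new zero) (lookup-++ˡ (just ∘ a) new i)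
                         (lookup-++ʳ a w zero) (lookup-++ˡ a w i) (realises (m ↑ʳ zero) (i ↑ˡ 1))

  open CutFilling using () renaming (filled to fill-cut)

  -- If l < x, l ⊥ o and x ≰ o, some x' satisfies l < x' < x and x' ⊥ o: fill the cut
  -- between l and x relative to the points l, x, o.
  between : ∀ {l x o} → l < x → l ⊥ o → ¬ (x ≤ o) →
            Σ P λ x' → (l < x') × (x' < x) × (x' ⊥ o)
  between {l} {x} {o} l<x l⊥o x≰o with fill-cut (l ∷ᵥ x ∷ᵥ o ∷ᵥ []ᵥ) distinct l<x
    where
    distinct : Injective _≡_ _≡_ (l ∷ᵥ x ∷ᵥ o ∷ᵥ []ᵥ)
    distinct = distinct₃ (proj₂ l<x)
                         (λ { refl → proj₁ l⊥o ≤-refl })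
                         (λ { refl → x≰o ≤-refl })
  ... | x' , cut = x' , (l≤x' , l≢x') , (x'≤x , x'≢x) , x'≰o , o≰x'
    where
    x≰l : ¬ (x ≤ l)
    x≰l = <⇒≱ antisym l<x
    l≤x' : l ≤ x'
    l≤x' = Equivalence.from (proj₁ (cut (# 0))) ≤-refl
    l≢x' : l ≢ x'
    l≢x' refl = x≰l (Equivalence.to (proj₂ (cut (# 0))) ≤-refl)
    x'≤x : x' ≤ x
    x'≤x = Equivalence.from (proj₂ (cut (# 1))) ≤-refl
    x'≢x : x' ≢ x
    x'≢x refl = x≰l (Equivalence.to (proj₁ (cut (# 1))) ≤-refl)
    x'≰o : ¬ (x' ≤ o)
    x'≰o = x≰o ∘ Equivalence.to (proj₂ (cut (# 2)))
    o≰x' : ¬ (o ≤ x')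
    o≰x' = proj₂ l⊥o ∘ Equivalence.to (proj₁ (cut (# 2)))

  -- Completeness of φAbv when y < x, x ⊥ z, y ⊥ z: realise abvTable over x, y, z.
  φAbv-from-abv-left : ∀ {x y z} → y < x → x ⊥ z → y ⊥ z → Sat Low φAbv x y z
  φAbv-from-abv-left {x} {y} {z} y<x x⊥z y⊥z
    with extend xyz (λ i j → T (abvTable i j)) (tablePartialOrder abvTable tt tt tt) base
    where
    xyz : Vector P 3
    xyz = x ∷ᵥ y ∷ᵥ z ∷ᵥ []ᵥ
    base : ∀ i j → T (abvTable (i ↑ˡ 3) (j ↑ˡ 3)) ⇔ (xyz i ≤ xyz j)
    base zero             zero             = holds⇔ ≤-refl
    base zero             (suc zero)       = fails⇔ (<⇒≱ antisym y<x)
    base zero             (suc (suc zero)) = fails⇔ (proj₁ x⊥z)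
    base (suc zero)       zero             = holds⇔ (proj₁ y<x)
    base (suc zero)       (suc zero)       = holds⇔ ≤-refl
    base (suc zero)       (suc (suc zero)) = fails⇔ (proj₁ y⊥z)
    base (suc (suc zero)) zero             = fails⇔ (proj₂ x⊥z)
    base (suc (suc zero)) (suc zero)       = fails⇔ (proj₂ y⊥z)
    base (suc (suc zero)) (suc (suc zero)) = holds⇔ ≤-refl
  ... | w , realises =
    sat-from-++ φAbv w (TableFacts.atoms abvTable _ realises (PPFormula3.atoms φAbv) tt)

  -- Completeness of φAbv; the case z < x is the case y < x with y and z exchanged.
  φAbv-from-abv : ∀ {x y z} → Abv x y z → Sat Low φAbv x y z
  φAbv-from-abv (inj₁ (y<x , x⊥z , y⊥z)) = φAbv-from-abv-left y<x x⊥z y⊥z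
  φAbv-from-abv (inj₂ (z<x , x⊥y , z⊥y)) = φAbv-swap (φAbv-from-abv-left z<x x⊥y z⊥y)

  -- Completeness of the formula for the strict order: realise belowTable over x', x.
  low-witnesses : ∀ {x' x} → x' < x → Σ P λ a → Σ P λ b → Low x' x a × Low a x' b
  low-witnesses {x'} {x} x'<x
    with extend x'x (λ i j → T (belowTable i j)) (tablePartialOrder belowTable tt tt tt) base
    where
    x'x : Vector P 2
    x'x = x' ∷ᵥ x ∷ᵥ []ᵥ
    base : ∀ i j → T (belowTable (i ↑ˡ 2) (j ↑ˡ 2)) ⇔ (x'x i ≤ x'x j)
    base zero       zero       = holds⇔ ≤-refl
    base zero       (suc zero) = holds⇔ (proj₁ x'<x)
    base (suc zero) zero       = fails⇔ (<⇒≱ antisym x'<x)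
    base (suc zero) (suc zero) = holds⇔ ≤-refl
  ... | w , realises = w (# 0) , w (# 1) , low (# 0) (# 1) (# 2) tt , low (# 2) (# 0) (# 3) tt
    where open TableFacts belowTable _ realises

  φU-from-parts : ∀ {x y z x'} → Sat Low φAbv x' y z → x' < x → Sat Low φU x y z
  φU-from-parts {x' = x'} (w , x'uv ∷ yx'w ∷ yzu ∷ zx'w ∷ zyv ∷ wuv ∷ []) x'<x
    with low-witnesses x'<x
  ... | a , b , x'xa , ax'b =
    (x' ∷ᵥ w (# 0) ∷ᵥ w (# 1) ∷ᵥ w (# 2) ∷ᵥ a ∷ᵥ b ∷ᵥ []ᵥ) ,
    x'uv ∷ yx'w ∷ yzu ∷ zx'w ∷ zyv ∷ wuv ∷ x'xa ∷ ax'b ∷ []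

  -- Completeness of φU: insert x' between the lower of y, z and x, avoiding the other.
  φU-from-u : ∀ {x y z} → U x y z → Sat Low φU x y z
  φU-from-u (inj₁ y<x , y⊥z) with between y<x y⊥z (proj₁ y⊥z ∘ ≤-trans (proj₁ y<x))
  ... | x' , y<x' , x'<x , x'⊥z = φU-from-parts (φAbv-from-abv (inj₁ (y<x' , x'⊥z , y⊥z))) x'<x
  φU-from-u (inj₂ z<x , y⊥z) with between z<x (⊥-sym y⊥z) (proj₂ y⊥z ∘ ≤-trans (proj₁ z<x))
  ... | x' , z<x' , x'<x , x'⊥y =
    φU-from-parts (φAbv-from-abv (inj₂ (z<x' , x'⊥y , ⊥-sym y⊥z))) x'<x

  abv-definable : PPDefinable3 Low Abv
  abv-definable = φAbv , λ x y z → mk⇔ φAbv-from-abv abv-from-φAbv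

  u-definable : PPDefinable3 Low U
  u-definable = φU , λ x y z → mk⇔ φU-from-u u-from-φU

mainTheorem17 : (P : Set) (_≤_ : P → P → Set) → IsRandomPartialOrder P _≤_ →
    PPDefinable3 (Relations.Low _≤_) (Relations.Abv _≤_) ×
    PPDefinable3 (Relations.Low _≤_) (Relations.U _≤_)
mainTheorem17 P _≤_ rpo = abv-definable , u-definable
  where open RandomOrder rpo
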